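{- Let $M$ be a loopfree matroid on $E=[n]$ of rank at least $2$, let $G_1\subsetneq\dots\subsetneq G_c$ be subsets of $E$ with $|G_c|\le n-2$, and let $M_{\mathcal{G}}=H_{G_1}\cdot\ldots\cdot H_{G_c}$, where $c<n-\mathrm{corank}(M)$. Then $M\cdot M_{\mathcal{G}}=0$ in $\mathbb{M}_n$ if and only if there exist $i\in\{1,\dots,c\}$ and a flat $F$ of $M$ with $\mathrm{rank}_M(F)=c-i+1$ and $F\cup G_i=E$.
   Context: $\mathrm{corank}(M)=n-\mathrm{rank}(M)$. $H_G:=U_{|G|,G}\oplus U_{|E\setminus G|-1,E\setminus G}$ is the loopfree corank-one matroid with coloop set $G$. In $\mathbb{M}_n$ (the ring of $\mathbb{Z}$-linear combinations of loopfree matroids on $[n]$, each identified with its indicator vector of maximal chains of flats), the product of loopfree matroids is $M\cdot N:=M\wedge N$ if the matroid intersection $M\wedge N=(M^*\vee N^*)^*$ is loopfree and $0$ otherwise; the product $H_{G_1}\cdot\ldots\cdot H_{G_c}$ equals the loopfree matroid $H_{G_1}\wedge\dots\wedge H_{G_c}$. -}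

module Defs where

open import Data.Nat using (ℕ; zero; suc; _+_; _∸_; _≤_; _<_; _⊓_)
import Data.Fin as Fin
open Fin using (Fin)
open import Data.Fin.Subset using (Subset; ⊥; ⊤; ⁅_⁆; _∈_; _∉_; _⊆_; _⊂_; ∁; _∩_; _∪_; _─_; ∣_∣)
open import Data.Bool using (true; false)
open import Data.Vec using (_∷_; [])
open import Data.List using (List; []; _∷_; map; _++_; foldr)
open import Data.List.Relation.Unary.All using (All)
open import Data.List.Membership.Propositional using () renaming (_∈_ to _∈ᴸ_)
open import Data.List.Relation.Unary.Any using (Any)
open import Data.Product using (Σ; _×_; ∃)
open import Data.Sum using (_⊎_)
open import Relation.Nullary using (¬_)
open import Relation.Binary.PropositionalEquality using (_≡_)

RankFn : ℕ → Set
RankFn n = Subset n → ℕ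

record IsMatroid {n : ℕ} (r : RankFn n) : Set where
  field
    bounded    : ∀ A → r A ≤ ∣ A ∣
    monotone   : ∀ {A B} → A ⊆ B → r A ≤ r B
    submodular : ∀ A B → r (A ∪ B) + r (A ∩ B) ≤ r A + r B

allSubsets : (n : ℕ) → List (Subset n)
allSubsets zero    = [] ∷ []
allSubsets (suc n) = map (true ∷_) (allSubsets n) ++ map (false ∷_) (allSubsets n)

-- minimum of f over all subsets X of [n] (the list is nonempty and contains ⊥)
minSubsets : {n : ℕ} → (Subset n → ℕ) → ℕ
minSubsets {n} f = foldr (λ X m → f X ⊓ m) (f ⊥) (allSubsets n)

rank : {n : ℕ} → RankFn n → ℕ
rank r = r ⊤

corank : {n : ℕ} → RankFn n → ℕ
corank {n} r = n ∸ rank r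

dual : {n : ℕ} → RankFn n → RankFn n
dual r A = ∣ A ∣ + r (∁ A) ∸ r ⊤

-- matroid union (Nash-Williams rank formula):
-- r_{M ∨ N}(A) = min_{Y ⊆ A} r_M(Y) + r_N(Y) + |A \ Y|   (Y = A ∩ X, X ranging over all subsets)
_∨ᴹ_ : {n : ℕ} → RankFn n → RankFn n → RankFn n
(r ∨ᴹ s) A = minSubsets (λ X → r (A ∩ X) + s (A ∩ X) + ∣ A ─ X ∣)

_∧ᴹ_ : {n : ℕ} → RankFn n → RankFn n → RankFn n
r ∧ᴹ s = dual (dual r ∨ᴹ dual s)

IsLoop : {n : ℕ} → RankFn n → Fin n → Set
IsLoop r e = r ⁅ e ⁆ ≡ 0

Loopfree : {n : ℕ} → RankFn n → Set
Loopfree r = ∀ e → ¬ IsLoop r e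

IsFlat : {n : ℕ} → RankFn n → Subset n → Set
IsFlat r F = ∀ e → e ∉ F → ¬ (r (F ∪ ⁅ e ⁆) ≡ r F)

-- uniform matroid U_{k,S} on the ground set S ⊆ [n] (elements outside S are not in
-- its ground set; in a direct sum they are covered by the other summand)
uniformOn : {n : ℕ} → ℕ → Subset n → RankFn n
uniformOn k S A = ∣ A ∩ S ∣ ⊓ k

directSum : {n : ℕ} → Subset n → RankFn n → RankFn n → RankFn n
directSum S r s A = r (A ∩ S) + s (A ∩ ∁ S)

H : {n : ℕ} → Subset n → RankFn n
H G = directSum G (uniformOn ∣ G ∣ G) (uniformOn (∣ ∁ G ∣ ∸ 1) (∁ G))

-- free matroid U_{n,n} (unit for ∧)
free : {n : ℕ} → RankFn n
free A = ∣ A ∣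

MG : {n c : ℕ} → (Fin c → Subset n) → RankFn n
MG {c = zero}  G = free
MG {c = suc c} G = H (G Fin.zero) ∧ᴹ MG (λ i → G (Fin.suc i))

Comparable : {n : ℕ} → Subset n → Subset n → Set
Comparable A B = A ⊆ B ⊎ B ⊆ A

IsMaxChainOfFlats : {n : ℕ} → RankFn n → List (Subset n) → Set
IsMaxChainOfFlats r ch =
  All (IsFlat r) ch ×
  All (λ A → All (Comparable A) ch) ch ×
  (∀ F → IsFlat r F → All (Comparable F) ch → F ∈ᴸ ch)

-- the indicator vector (in ℤ^{chains}) of a matroid is zero iff it has no maximal chain of flats
IndicatorZero : {n : ℕ} → RankFn n → Set
IndicatorZero r = ∀ ch → ¬ IsMaxChainOfFlats r ch

-- M · N = 0 in 𝕄_n : M · N is M ∧ N if loopfree and 0 otherwise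
ProductIsZero : {n : ℕ} → RankFn n → RankFn n → Set
ProductIsZero r s = Loopfree (r ∧ᴹ s) → IndicatorZero (r ∧ᴹ s)

-- The dual of M ∧ M_𝒢 is the union M* ∨ M_𝒢*, and M_𝒢* is the matroid induced by
-- T Z = #{i | Z ⊈ Gᵢ}, because H_G* has rank function Z ↦ [Z ⊈ G].  By the Nash-Williams
-- formula, e is a loop of M ∧ M_𝒢 iff ψ Z = r_M (E ∖ Z) + T Z attains its minimum at some Z ∌ e.
-- Since ψ E = c, such a Z has T Z < c; the Gᵢ form a chain, so Z ⊆ Gⱼ for j = T Z, and E ∖ Z has
-- rank ≤ c - j, hence lies in a flat F of rank c - j, with F ∪ Gⱼ = E.  Conversely such an F gives
-- ψ (E ∖ F) ≤ c = ψ E with E ∖ F ≠ E, which forces a minimiser that misses some element.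
-- Finally, every matroid has a maximal chain of flats, so M · M_𝒢 = 0 just says M ∧ M_𝒢 has a loop.

{-# OPTIONS --safe #-}
module Submission where

open import Defs
import Algebra.Lattice.Properties.BooleanAlgebra as BooleanAlgebraProperties
open import Data.Bool using (true; false)
open import Data.Bool.Properties using (∧-zeroʳ; ∧-identityʳ)
open import Data.Empty using (⊥-elim)
import Data.Fin as Fin
open Fin using (Fin; toℕ)
open import Data.Fin.Properties using (any?; all?; toℕ<n)
open import Data.Fin.Subset
  using (Subset; ⊤; ⊥; ⁅_⁆; _∈_; _∉_; _⊆_; _⊂_; ∁; _∩_; _∪_; _─_; ∣_∣; Nonempty; Empty)
open import Data.Fin.Subset.Properties
open import Data.List using (List; []; _∷_; map; foldr; foldl)
open import Data.List.Membership.Propositional using () renaming (_∈_ to _∈ᴸ_)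
open import Data.List.Membership.Propositional.Properties using (∈-map⁺; ∈-++⁺ˡ; ∈-++⁺ʳ)
open import Data.List.Relation.Unary.All as All using (All)
open import Data.List.Relation.Unary.Any using (here; there)
open import Data.Nat using (ℕ; zero; suc; _+_; _∸_; _≤_; _<_; _⊓_; _≤?_; _≟_; z≤n; s≤s)
open import Data.Nat.Induction using (<-wellFounded)
open import Data.Nat.Properties
open import Algebra.Properties.CommutativeSemigroup +-commutativeSemigroup
  using (x∙yz≈y∙xz; x∙yz≈xz∙y)
open import Data.Nat.Tactic.RingSolver using (solve-∀)
open import Data.Product using (Σ; ∃; ∃₂; _×_; _,_; proj₁; proj₂; map₂)
open import Data.Sum using (_⊎_; inj₁; inj₂; swap)
open import Data.Vec using (_∷_; [])
open import Function using (_∘_)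
open import Function.Bundles using (_⇔_; mk⇔; module Equivalence)
open import Function.Properties.Equivalence using () renaming (trans to ⇔-trans)
open import Induction.WellFounded using (Acc; acc)
open import Relation.Binary.PropositionalEquality
open import Relation.Nullary using (Dec; yes; no; ¬_)
open import Relation.Nullary.Decidable using (¬?; _×-dec_; _⊎-dec_; _→-dec_; decidable-stable)

module _ {n : ℕ} where
  open BooleanAlgebraProperties (∪-∩-booleanAlgebra n) public
    using () renaming (¬-involutive to ∁-involutive; ¬⊤≈⊥ to ∁⊤≡⊥; ¬⊥≈⊤ to ∁⊥≡⊤)

p─q≡p∩∁q : ∀ {n} (p q : Subset n) → p ─ q ≡ p ∩ ∁ q
p─q≡p∩∁q []      []          = refl
p─q≡p∩∁q (x ∷ p) (true ∷ q)  = cong₂ _∷_ (sym (∧-zeroʳ x)) (p─q≡p∩∁q p q)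
p─q≡p∩∁q (x ∷ p) (false ∷ q) = cong₂ _∷_ (sym (∧-identityʳ x)) (p─q≡p∩∁q p q)

∣p∩q∣+∣p─q∣≡∣p∣ : ∀ {n} (p q : Subset n) → ∣ p ∩ q ∣ + ∣ p ─ q ∣ ≡ ∣ p ∣
∣p∩q∣+∣p─q∣≡∣p∣ []          []          = refl
∣p∩q∣+∣p─q∣≡∣p∣ (true ∷ p)  (true ∷ q)  = cong suc (∣p∩q∣+∣p─q∣≡∣p∣ p q)
∣p∩q∣+∣p─q∣≡∣p∣ (true ∷ p)  (false ∷ q) = trans (+-suc _ _) (cong suc (∣p∩q∣+∣p─q∣≡∣p∣ p q))
∣p∩q∣+∣p─q∣≡∣p∣ (false ∷ p) (true ∷ q)  = ∣p∩q∣+∣p─q∣≡∣p∣ p q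
∣p∩q∣+∣p─q∣≡∣p∣ (false ∷ p) (false ∷ q) = ∣p∩q∣+∣p─q∣≡∣p∣ p q

∣p∩q∣+∣p∩∁q∣≡∣p∣ : ∀ {n} (p q : Subset n) → ∣ p ∩ q ∣ + ∣ p ∩ ∁ q ∣ ≡ ∣ p ∣
∣p∩q∣+∣p∩∁q∣≡∣p∣ p q = subst (λ d → ∣ p ∩ q ∣ + ∣ d ∣ ≡ ∣ p ∣) (p─q≡p∩∁q p q) (∣p∩q∣+∣p─q∣≡∣p∣ p q)

∣p∣+∣∁p∣≡n : ∀ {n} (p : Subset n) → ∣ p ∣ + ∣ ∁ p ∣ ≡ n
∣p∣+∣∁p∣≡n p = trans (cong (∣ p ∣ +_) (∣∁p∣≡n∸∣p∣ p)) (m+[n∸m]≡n (∣p∣≤n p))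

∣p─q∩r∣≡∣p∩q─r∣+∣p─q∣ : ∀ {n} (p q r : Subset n) → ∣ p ─ q ∩ r ∣ ≡ ∣ p ∩ q ─ r ∣ + ∣ p ─ q ∣
∣p─q∩r∣≡∣p∩q─r∣+∣p─q∣ []          []          []          = refl
∣p─q∩r∣≡∣p∩q─r∣+∣p─q∣ (true ∷ p)  (true ∷ q)  (true ∷ r)  = ∣p─q∩r∣≡∣p∩q─r∣+∣p─q∣ p q r
∣p─q∩r∣≡∣p∩q─r∣+∣p─q∣ (true ∷ p)  (true ∷ q)  (false ∷ r) = cong suc (∣p─q∩r∣≡∣p∩q─r∣+∣p─q∣ p q r)
∣p─q∩r∣≡∣p∩q─r∣+∣p─q∣ (true ∷ p)  (false ∷ q) (true ∷ r)  =
  trans (cong suc (∣p─q∩r∣≡∣p∩q─r∣+∣p─q∣ p q r)) (sym (+-suc _ _))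
∣p─q∩r∣≡∣p∩q─r∣+∣p─q∣ (true ∷ p)  (false ∷ q) (false ∷ r) =
  trans (cong suc (∣p─q∩r∣≡∣p∩q─r∣+∣p─q∣ p q r)) (sym (+-suc _ _))
∣p─q∩r∣≡∣p∩q─r∣+∣p─q∣ (false ∷ p) (true ∷ q)  (true ∷ r)  = ∣p─q∩r∣≡∣p∩q─r∣+∣p─q∣ p q r
∣p─q∩r∣≡∣p∩q─r∣+∣p─q∣ (false ∷ p) (true ∷ q)  (false ∷ r) = ∣p─q∩r∣≡∣p∩q─r∣+∣p─q∣ p q r
∣p─q∩r∣≡∣p∩q─r∣+∣p─q∣ (false ∷ p) (false ∷ q) (true ∷ r)  = ∣p─q∩r∣≡∣p∩q─r∣+∣p─q∣ p q r
∣p─q∩r∣≡∣p∩q─r∣+∣p─q∣ (false ∷ p) (false ∷ q) (false ∷ r) = ∣p─q∩r∣≡∣p∩q─r∣+∣p─q∣ p q r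

∩-monoˡ-⊆ : ∀ {n} {p q : Subset n} (r : Subset n) → p ⊆ q → p ∩ r ⊆ q ∩ r
∩-monoˡ-⊆ {p = p} r p⊆q x∈p∩r with x∈p∩q⁻ p r x∈p∩r
... | x∈p , x∈r = x∈p∩q⁺ (p⊆q x∈p , x∈r)

p≡⊤⊎∃∉p : ∀ {n} (p : Subset n) → p ≡ ⊤ ⊎ ∃ (_∉ p)
p≡⊤⊎∃∉p p with any? (λ x → ¬? (x ∈? p))
... | yes outside = inj₂ outside
... | no  full    = inj₁ (⊆-antisym ⊆⊤ λ {x} _ → decidable-stable (x ∈? p) (λ x∉p → full (x , x∉p)))

∁p⊆q⇒p∪q≡⊤ : ∀ {n} {p q : Subset n} → ∁ p ⊆ q → p ∪ q ≡ ⊤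
∁p⊆q⇒p∪q≡⊤ {p = p} {q} ∁p⊆q = ⊆-antisym ⊆⊤ λ {x} _ → cover x
  where
  cover : ∀ x → x ∈ p ∪ q
  cover x with x ∈? p
  ... | yes x∈p = x∈p∪q⁺ (inj₁ x∈p)
  ... | no  x∉p = x∈p∪q⁺ (inj₂ (∁p⊆q (x∉p⇒x∈∁p x∉p)))

p∪q≡⊤⇒∁p⊆q : ∀ {n} {p q : Subset n} → p ∪ q ≡ ⊤ → ∁ p ⊆ q
p∪q≡⊤⇒∁p⊆q {p = p} {q} p∪q≡⊤ {x} x∈∁p with x∈p∪q⁻ p q (subst (x ∈_) (sym p∪q≡⊤) ∈⊤)
... | inj₁ x∈p = ⊥-elim (x∈∁p⇒x∉p x∈∁p x∈p)
... | inj₂ x∈q = x∈q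

∁p⊆q⇒∁q⊆p : ∀ {n} {p q : Subset n} → ∁ p ⊆ q → ∁ q ⊆ p
∁p⊆q⇒∁q⊆p ∁p⊆q x∈∁q = x∉∁p⇒x∈p λ x∈∁p → x∈∁p⇒x∉p x∈∁q (∁p⊆q x∈∁p)

x∉p⇒⁅x⁆⊆∁p : ∀ {n} {x : Fin n} {p : Subset n} → x ∉ p → ⁅ x ⁆ ⊆ ∁ p
x∉p⇒⁅x⁆⊆∁p {x = x} x∉p y∈⁅x⁆ = subst (_∈ ∁ _) (sym (x∈⁅y⁆⇒x≡y x y∈⁅x⁆)) (x∉p⇒x∈∁p x∉p)

x∉p⇒p⊆∁⁅x⁆ : ∀ {n} {x : Fin n} {p : Subset n} → x ∉ p → p ⊆ ∁ ⁅ x ⁆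
x∉p⇒p⊆∁⁅x⁆ {x = x} x∉p y∈p = x∉p⇒x∈∁p λ y∈⁅x⁆ → x∉p (subst (_∈ _) (x∈⁅y⁆⇒x≡y x y∈⁅x⁆) y∈p)

x∈p⇒0<∣p∣ : ∀ {n} {x : Fin n} {p : Subset n} → x ∈ p → 0 < ∣ p ∣
x∈p⇒0<∣p∣ {x = x} {p} x∈p = subst (_≤ ∣ p ∣) (∣⁅x⁆∣≡1 x)
  (p⊆q⇒∣p∣≤∣q∣ λ y∈⁅x⁆ → subst (_∈ p) (sym (x∈⁅y⁆⇒x≡y x y∈⁅x⁆)) x∈p)

∈-allSubsets : ∀ {n} (p : Subset n) → p ∈ᴸ allSubsets n
∈-allSubsets []                  = here refl
∈-allSubsets {suc n} (true ∷ p)  = ∈-++⁺ˡ (∈-map⁺ (true ∷_) (∈-allSubsets p))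
∈-allSubsets {suc n} (false ∷ p) =
  ∈-++⁺ʳ (map (true ∷_) (allSubsets n)) (∈-map⁺ (false ∷_) (∈-allSubsets p))

module _ {n : ℕ} (f : Subset n → ℕ) where
  private
    minOf : List (Subset n) → ℕ
    minOf = foldr (λ X m → f X ⊓ m) (f ⊥)

    minOf-≤ : ∀ {X} Xs → X ∈ᴸ Xs → minOf Xs ≤ f X
    minOf-≤ (Y ∷ Ys) (here refl) = m⊓n≤m (f Y) (minOf Ys)
    minOf-≤ (Y ∷ Ys) (there X∈Ys) = ≤-trans (m⊓n≤n (f Y) (minOf Ys)) (minOf-≤ Ys X∈Ys)

    minOf-attained : ∀ Xs → ∃ λ X → minOf Xs ≡ f X
    minOf-attained []       = ⊥ , refl
    minOf-attained (Y ∷ Ys) with ⊓-sel (f Y) (minOf Ys)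
    ... | inj₁ eq = Y , eq
    ... | inj₂ eq = proj₁ (minOf-attained Ys) , trans eq (proj₂ (minOf-attained Ys))

  minSubsets-≤ : ∀ X → minSubsets f ≤ f X
  minSubsets-≤ X = minOf-≤ (allSubsets n) (∈-allSubsets X)

  minSubsets-attained : ∃ λ X → minSubsets f ≡ f X
  minSubsets-attained = minOf-attained (allSubsets n)

  minSubsets-greatest : ∀ {k} → (∀ X → k ≤ f X) → k ≤ minSubsets f
  minSubsets-greatest {k} k≤f with minSubsets-attained
  ... | X , min≡fX = subst (k ≤_) (sym min≡fX) (k≤f X)

minSubsets-mono : ∀ {n} {f g : Subset n → ℕ} → (∀ X → f X ≤ g X) → minSubsets f ≤ minSubsets g
minSubsets-mono {f = f} f≤g = minSubsets-greatest _ λ X → ≤-trans (minSubsets-≤ f X) (f≤g X)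

minSubsets-cong : ∀ {n} {f g : Subset n → ℕ} → f ≗ g → minSubsets f ≡ minSubsets g
minSubsets-cong f≗g =
  ≤-antisym (minSubsets-mono (≤-reflexive ∘ f≗g)) (minSubsets-mono (≤-reflexive ∘ sym ∘ f≗g))

IsMinimiser : ∀ {n} → (Subset n → ℕ) → Subset n → Set
IsMinimiser ψ Z = ∀ W → ψ Z ≤ ψ W

minimiser : ∀ {n} (ψ : Subset n → ℕ) → ∃ (IsMinimiser ψ)
minimiser ψ with minSubsets-attained ψ
... | Z , min≡ψZ = Z , λ W → subst (_≤ ψ W) min≡ψZ (minSubsets-≤ ψ W)

-- If every minimiser were ⊤, a set W ≠ ⊤ with ψ W ≤ ψ ⊤ would be a minimiser.
minimiser-avoiding : ∀ {n} (ψ : Subset n → ℕ) {e W} → e ∉ W → ψ W ≤ ψ ⊤ →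
                     ∃₂ λ x Z → x ∉ Z × IsMinimiser ψ Z
minimiser-avoiding ψ {e} {W} e∉W ψW≤ψ⊤ with minimiser ψ
... | Z , Z-min with p≡⊤⊎∃∉p Z
...   | inj₂ (x , x∉Z) = x , Z , x∉Z , Z-min
...   | inj₁ Z≡⊤       = e , W , e∉W , λ X → ≤-trans ψW≤ψ⊤ (subst (λ Y → ψ Y ≤ ψ X) Z≡⊤ (Z-min X))

IsMonotone : ∀ {n} → (Subset n → ℕ) → Set
IsMonotone f = ∀ {A B} → A ⊆ B → f A ≤ f B

-- The rank function of the matroid induced by f; r ∨ᴹ s unfolds to induced (λ Z → r Z + s Z).
induced : ∀ {n} → (Subset n → ℕ) → Subset n → ℕ
induced f A = minSubsets (λ X → f (A ∩ X) + ∣ A ─ X ∣)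

module _ {n : ℕ} (f : Subset n → ℕ) where

  induced-≤ : ∀ A X → induced f A ≤ f (A ∩ X) + ∣ A ─ X ∣
  induced-≤ A = minSubsets-≤ (λ X → f (A ∩ X) + ∣ A ─ X ∣)

  induced-attained : ∀ A → ∃ λ X → induced f A ≡ f (A ∩ X) + ∣ A ─ X ∣
  induced-attained A = minSubsets-attained (λ X → f (A ∩ X) + ∣ A ─ X ∣)

  induced-≤-self : ∀ A → induced f A ≤ f A
  induced-≤-self A = subst (induced f A ≤_) witness⊤ (induced-≤ A ⊤)
    where
    witness⊤ : f (A ∩ ⊤) + ∣ A ─ ⊤ ∣ ≡ f A
    witness⊤ rewrite ∩-identityʳ A | p─⊤≡⊥ A | ∣⊥∣≡0 n = +-identityʳ (f A)

  induced-⊥ : f ⊥ ≡ 0 → induced f ⊥ ≡ 0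
  induced-⊥ f⊥≡0 = n≤0⇒n≡0 (subst (induced f ⊥ ≤_) f⊥≡0 (induced-≤-self ⊥))

  induced-⊤-≤ : ∀ A → induced f ⊤ ≤ induced f A + ∣ ∁ A ∣
  induced-⊤-≤ A with induced-attained A
  ... | X , eq = begin
    induced f ⊤                             ≤⟨ induced-≤ ⊤ (A ∩ X) ⟩
    f (⊤ ∩ (A ∩ X)) + ∣ ⊤ ─ A ∩ X ∣         ≡⟨ cong₂ _+_ (cong f (∩-identityˡ (A ∩ X)))
                                                        (∣p─q∩r∣≡∣p∩q─r∣+∣p─q∣ ⊤ A X) ⟩
    f (A ∩ X) + (∣ ⊤ ∩ A ─ X ∣ + ∣ ⊤ ─ A ∣) ≡⟨ cong₂ (λ B C → f (A ∩ X) + (∣ B ─ X ∣ + ∣ C ∣))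
                                                        (∩-identityˡ A) ⊤─A≡∁A ⟩
    f (A ∩ X) + (∣ A ─ X ∣ + ∣ ∁ A ∣)       ≡⟨ sym (+-assoc (f (A ∩ X)) _ _) ⟩
    f (A ∩ X) + ∣ A ─ X ∣ + ∣ ∁ A ∣         ≡⟨ cong (_+ ∣ ∁ A ∣) (sym eq) ⟩
    induced f A + ∣ ∁ A ∣                   ∎
    where
    open ≤-Reasoning
    ⊤─A≡∁A : ⊤ ─ A ≡ ∁ A
    ⊤─A≡∁A = trans (p─q≡p∩∁q ⊤ A) (∩-identityˡ (∁ A))

induced-cong : ∀ {n} {f g : Subset n → ℕ} → f ≗ g → induced f ≗ induced g
induced-cong f≗g A = minSubsets-cong λ X → cong (_+ ∣ A ─ X ∣) (f≗g (A ∩ X))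

induced-absorb : ∀ {n} (f g : Subset n → ℕ) → IsMonotone f →
                 induced (λ Z → f Z + induced g Z) ≗ induced (λ Z → f Z + g Z)
induced-absorb f g f-mono A = ≤-antisym
  (minSubsets-mono λ X → +-monoˡ-≤ ∣ A ─ X ∣ (+-monoʳ-≤ (f (A ∩ X)) (induced-≤-self g (A ∩ X))))
  (minSubsets-greatest _ through)
  where
  -- a witness X for the outer minimum and Z for the inner one combine into the witness X ∩ Z
  through : ∀ X → induced (λ Z → f Z + g Z) A ≤ f (A ∩ X) + induced g (A ∩ X) + ∣ A ─ X ∣
  through X with induced-attained g (A ∩ X)
  ... | Z , eq = begin
    induced (λ Z → f Z + g Z) A
      ≤⟨ induced-≤ (λ Z → f Z + g Z) A (X ∩ Z) ⟩
    f (A ∩ (X ∩ Z)) + g (A ∩ (X ∩ Z)) + ∣ A ─ X ∩ Z ∣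
      ≤⟨ +-monoˡ-≤ _ (+-mono-≤ (f-mono A∩[X∩Z]⊆A∩X) (≤-reflexive (cong g (sym (∩-assoc A X Z))))) ⟩
    f (A ∩ X) + g ((A ∩ X) ∩ Z) + ∣ A ─ X ∩ Z ∣
      ≡⟨ cong (f (A ∩ X) + g ((A ∩ X) ∩ Z) +_) (∣p─q∩r∣≡∣p∩q─r∣+∣p─q∣ A X Z) ⟩
    f (A ∩ X) + g ((A ∩ X) ∩ Z) + (∣ A ∩ X ─ Z ∣ + ∣ A ─ X ∣)
      ≡⟨ regroup (f (A ∩ X)) (g ((A ∩ X) ∩ Z)) ∣ A ∩ X ─ Z ∣ ∣ A ─ X ∣ ⟩
    f (A ∩ X) + (g ((A ∩ X) ∩ Z) + ∣ A ∩ X ─ Z ∣) + ∣ A ─ X ∣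
      ≡⟨ cong (λ m → f (A ∩ X) + m + ∣ A ─ X ∣) (sym eq) ⟩
    f (A ∩ X) + induced g (A ∩ X) + ∣ A ─ X ∣ ∎
    where
    open ≤-Reasoning
    A∩[X∩Z]⊆A∩X : A ∩ (X ∩ Z) ⊆ A ∩ X
    A∩[X∩Z]⊆A∩X = subst (_⊆ A ∩ X) (∩-assoc A X Z) (p∩q⊆p (A ∩ X) Z)
    regroup : ∀ a b c d → a + b + (c + d) ≡ a + (b + c) + d
    regroup = solve-∀

dual-cong : ∀ {n} {r s : RankFn n} → r ≗ s → dual r ≗ dual s
dual-cong r≗s A = cong₂ (λ x y → ∣ A ∣ + x ∸ y) (r≗s (∁ A)) (r≗s ⊤)

private
  ∸-cancel : ∀ a b x R → R ≤ b + x → R ≤ a + b → a + (b + x ∸ R) ∸ (a + b ∸ R) ≡ x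
  ∸-cancel a b x R R≤b+x R≤a+b = begin
    a + (b + x ∸ R) ∸ (a + b ∸ R) ≡⟨ cong (_∸ (a + b ∸ R)) (begin
      a + (b + x ∸ R)               ≡⟨ sym (+-∸-assoc a R≤b+x) ⟩
      a + (b + x) ∸ R               ≡⟨ cong (_∸ R) (sym (+-assoc a b x)) ⟩
      a + b + x ∸ R                 ≡⟨ +-∸-comm x R≤a+b ⟩
      a + b ∸ R + x                 ∎) ⟩
    a + b ∸ R + x ∸ (a + b ∸ R)   ≡⟨ m+n∸m≡n (a + b ∸ R) x ⟩
    x                             ∎
    where open ≡-Reasoning

dual-involutive : ∀ {n} (r : RankFn n) → r ⊥ ≡ 0 → (∀ A → r ⊤ ≤ r A + ∣ ∁ A ∣) → dual (dual r) ≗ r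
dual-involutive {n} r r⊥≡0 r⊤≤ A = begin
  ∣ A ∣ + (∣ ∁ A ∣ + r (∁ (∁ A)) ∸ r ⊤) ∸ (∣ ⊤ {n} ∣ + r (∁ ⊤) ∸ r ⊤)
    ≡⟨ cong₂ (λ B m → ∣ A ∣ + (∣ ∁ A ∣ + r B ∸ r ⊤) ∸ (m ∸ r ⊤)) (∁-involutive A) ∣⊤∣+r[∁⊤] ⟩
  ∣ A ∣ + (∣ ∁ A ∣ + r A ∸ r ⊤) ∸ (∣ A ∣ + ∣ ∁ A ∣ ∸ r ⊤)
    ≡⟨ ∸-cancel ∣ A ∣ ∣ ∁ A ∣ (r A) (r ⊤) (subst (r ⊤ ≤_) (+-comm (r A) _) (r⊤≤ A)) r⊤≤n ⟩
  r A ∎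
  where
  open ≡-Reasoning
  ∣⊤∣+r[∁⊤] : ∣ ⊤ {n} ∣ + r (∁ ⊤) ≡ ∣ A ∣ + ∣ ∁ A ∣
  ∣⊤∣+r[∁⊤] = begin
    ∣ ⊤ {n} ∣ + r (∁ ⊤) ≡⟨ cong₂ _+_ (∣⊤∣≡n n) (trans (cong r ∁⊤≡⊥) r⊥≡0) ⟩
    n + 0           ≡⟨ +-identityʳ n ⟩
    n               ≡⟨ sym (∣p∣+∣∁p∣≡n A) ⟩
    ∣ A ∣ + ∣ ∁ A ∣ ∎
  r⊤≤n : r ⊤ ≤ ∣ A ∣ + ∣ ∁ A ∣
  r⊤≤n = subst (r ⊤ ≤_)
    (trans (cong₂ _+_ r⊥≡0 (cong ∣_∣ (∁⊥≡⊤ {n}))) (trans (∣⊤∣≡n n) (sym (∣p∣+∣∁p∣≡n A))))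
    (r⊤≤ ⊥)

dual-induced-involutive : ∀ {n} (f : Subset n → ℕ) → f ⊥ ≡ 0 → dual (dual (induced f)) ≗ induced f
dual-induced-involutive f f⊥≡0 = dual-involutive (induced f) (induced-⊥ f f⊥≡0) (induced-⊤-≤ f)

module Matroid {n : ℕ} {M : RankFn n} (isMatroid : IsMatroid M) where
  open IsMatroid isMatroid

  M⊥≡0 : M ⊥ ≡ 0
  M⊥≡0 = n≤0⇒n≡0 (subst (M ⊥ ≤_) (∣⊥∣≡0 n) (bounded ⊥))

  M⊤≤n : M ⊤ ≤ n
  M⊤≤n = subst (M ⊤ ≤_) (∣⊤∣≡n n) (bounded ⊤)

  ∪-≤ : ∀ A B → M (A ∪ B) ≤ M A + ∣ B ∣
  ∪-≤ A B = ≤-trans (m+n≤o⇒m≤o (M (A ∪ B)) (submodular A B)) (+-monoʳ-≤ (M A) (bounded B))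

  ∪⁅⁆-≤ : ∀ A x → M (A ∪ ⁅ x ⁆) ≤ suc (M A)
  ∪⁅⁆-≤ A x =
    subst (M (A ∪ ⁅ x ⁆) ≤_) (trans (cong (M A +_) (∣⁅x⁆∣≡1 x)) (+-comm (M A) 1)) (∪-≤ A ⁅ x ⁆)

  M⊤+dual : ∀ A → M ⊤ + dual M A ≡ ∣ A ∣ + M (∁ A)
  M⊤+dual A =
    m+[n∸m]≡n (subst₂ _≤_ (cong M (∪-inverseˡ A)) (+-comm (M (∁ A)) ∣ A ∣) (∪-≤ (∁ A) A))

  dual-mono : IsMonotone (dual M)
  dual-mono {A} {B} A⊆B = ∸-monoˡ-≤ (M ⊤) (begin
    ∣ A ∣ + M (∁ A)                 ≤⟨ +-monoʳ-≤ (∣ A ∣) (≤-trans (monotone ∁A⊆∁B∪[B─A])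
                                                                (∪-≤ (∁ B) (B ─ A))) ⟩
    ∣ A ∣ + (M (∁ B) + ∣ B ─ A ∣)   ≡⟨ x∙yz≈xz∙y (∣ A ∣) (M (∁ B)) (∣ B ─ A ∣) ⟩
    ∣ A ∣ + ∣ B ─ A ∣ + M (∁ B)     ≡⟨ cong (λ C → ∣ C ∣ + ∣ B ─ A ∣ + M (∁ B)) B∩A≡A ⟨
    ∣ B ∩ A ∣ + ∣ B ─ A ∣ + M (∁ B) ≡⟨ cong (_+ M (∁ B)) (∣p∩q∣+∣p─q∣≡∣p∣ B A) ⟩
    ∣ B ∣ + M (∁ B)                 ∎)
    where
    open ≤-Reasoning
    ∁A⊆∁B∪[B─A] : ∁ A ⊆ ∁ B ∪ (B ─ A)
    ∁A⊆∁B∪[B─A] {x} x∈∁A with x ∈? B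
    ... | yes x∈B = x∈p∪q⁺ (inj₂ (x∈p∧x∉q⇒x∈p─q x∈B (x∈∁p⇒x∉p x∈∁A)))
    ... | no  x∉B = x∈p∪q⁺ (inj₁ (x∉p⇒x∈∁p x∉B))
    B∩A≡A : B ∩ A ≡ A
    B∩A≡A = ⊆-antisym (p∩q⊆q B A) (λ x∈A → x∈p∩q⁺ (A⊆B x∈A , x∈A))

  positive-rank⇒nonempty : ∀ {F} → 0 < M F → Nonempty F
  positive-rank⇒nonempty {F} 0<MF with nonempty? F
  ... | yes F≢∅ = F≢∅
  ... | no  F≡∅ = ⊥-elim (<⇒≢ 0<MF (sym (trans (cong M (Empty-unique F≡∅)) M⊥≡0)))

  flat-extension : ∀ Y t → M Y ≤ t → t ≤ M ⊤ → ∃ λ F → IsFlat M F × Y ⊆ F × M F ≡ t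
  flat-extension Y = extend Y (<-wellFounded ∣ ∁ Y ∣)
    where
    ∣∁[Y∪⁅x⁆]∣<∣∁Y∣ : ∀ {Y x} → x ∉ Y → ∣ ∁ (Y ∪ ⁅ x ⁆) ∣ < ∣ ∁ Y ∣
    ∣∁[Y∪⁅x⁆]∣<∣∁Y∣ {Y} {x} x∉Y = p⊂q⇒∣p∣<∣q∣
      (p⊆q⇒∁p⊇∁q (p⊆p∪q ⁅ x ⁆) , x , x∉p⇒x∈∁p x∉Y , λ x∈∁[Y∪⁅x⁆] →
        x∈∁p⇒x∉p x∈∁[Y∪⁅x⁆] (x∈p∪q⁺ (inj₂ (x∈⁅x⁆ x))))

    -- Keep adding elements while the rank stays ≤ t; when that is no longer possible,
    -- Y is closed and (since the rank grows by at most one per element) of rank t.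
    extend : ∀ Y → Acc _<_ ∣ ∁ Y ∣ → ∀ t → M Y ≤ t → t ≤ M ⊤ →
             ∃ λ F → IsFlat M F × Y ⊆ F × M F ≡ t
    extend Y (acc smaller) t MY≤t t≤M⊤ with any? (λ x → ¬? (x ∈? Y) ×-dec (M (Y ∪ ⁅ x ⁆) ≤? t))
    ... | yes (x , x∉Y , MYx≤t)
      with extend (Y ∪ ⁅ x ⁆) (smaller (∣∁[Y∪⁅x⁆]∣<∣∁Y∣ x∉Y)) t MYx≤t t≤M⊤
    ...   | F , F-flat , Yx⊆F , MF≡t = F , F-flat , ⊆-trans (p⊆p∪q ⁅ x ⁆) Yx⊆F , MF≡t
    extend Y _ t MY≤t t≤M⊤ | no stuck = Y , Y-flat , ⊆-refl , ≤-antisym MY≤t t≤MY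
      where
      Y-flat : IsFlat M Y
      Y-flat x x∉Y MYx≡MY = stuck (x , x∉Y , subst (_≤ t) (sym MYx≡MY) MY≤t)
      t≤MY : t ≤ M Y
      t≤MY with p≡⊤⊎∃∉p Y
      ... | inj₁ Y≡⊤       = subst (λ Z → t ≤ M Z) (sym Y≡⊤) t≤M⊤
      ... | inj₂ (x , x∉Y) = ≮⇒≥ λ MY<t → stuck (x , x∉Y , ≤-trans (∪⁅⁆-≤ Y x) MY<t)

  module _ (g : Subset n → ℕ) where
    private
      ψ : Subset n → ℕ
      ψ Z = M (∁ Z) + g Z

      V : Subset n → ℕ
      V = induced (λ Z → dual M Z + g Z)

      M⊤+V-term : ∀ A X → M ⊤ + (dual M (A ∩ X) + g (A ∩ X) + ∣ A ─ X ∣) ≡ ∣ A ∣ + ψ (A ∩ X)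
      M⊤+V-term A X = begin
        M ⊤ + (dual M (A ∩ X) + g (A ∩ X) + ∣ A ─ X ∣)
          ≡⟨ regroupˡ (M ⊤) (dual M (A ∩ X)) (g (A ∩ X)) (∣ A ─ X ∣) ⟩
        M ⊤ + dual M (A ∩ X) + (g (A ∩ X) + ∣ A ─ X ∣)
          ≡⟨ cong (_+ (g (A ∩ X) + ∣ A ─ X ∣)) (M⊤+dual (A ∩ X)) ⟩
        ∣ A ∩ X ∣ + M (∁ (A ∩ X)) + (g (A ∩ X) + ∣ A ─ X ∣)
          ≡⟨ regroupʳ (∣ A ∩ X ∣) (M (∁ (A ∩ X))) (g (A ∩ X)) (∣ A ─ X ∣) ⟩
        ∣ A ∩ X ∣ + ∣ A ─ X ∣ + ψ (A ∩ X)
          ≡⟨ cong (_+ ψ (A ∩ X)) (∣p∩q∣+∣p─q∣≡∣p∣ A X) ⟩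
        ∣ A ∣ + ψ (A ∩ X) ∎
        where
        open ≡-Reasoning
        regroupˡ : ∀ a b c d → a + (b + c + d) ≡ a + b + (c + d)
        regroupˡ = solve-∀
        regroupʳ : ∀ a b c d → a + b + (c + d) ≡ a + d + (b + c)
        regroupʳ = solve-∀

      M⊤+V-≤ : ∀ A X → M ⊤ + V A ≤ ∣ A ∣ + ψ (A ∩ X)
      M⊤+V-≤ A X = subst (M ⊤ + V A ≤_) (M⊤+V-term A X)
                         (+-monoʳ-≤ (M ⊤) (induced-≤ (λ Z → dual M Z + g Z) A X))

      M⊤+V-attained : ∀ A → ∃ λ X → M ⊤ + V A ≡ ∣ A ∣ + ψ (A ∩ X)
      M⊤+V-attained A with induced-attained (λ Z → dual M Z + g Z) A
      ... | X , eq = X , trans (cong (M ⊤ +_) eq) (M⊤+V-term A X)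

      ∣⁅x⁆∣+[∣∁⁅x⁆∣+k]≡n+k : ∀ x k → ∣ ⁅ x ⁆ ∣ + (∣ ∁ ⁅ x ⁆ ∣ + k) ≡ n + k
      ∣⁅x⁆∣+[∣∁⁅x⁆∣+k]≡n+k x k =
        trans (sym (+-assoc ∣ ⁅ x ⁆ ∣ _ k)) (cong (_+ k) (∣p∣+∣∁p∣≡n ⁅ x ⁆))

      M⊤+V⊤≤ : ∀ W → M ⊤ + V ⊤ ≤ n + ψ W
      M⊤+V⊤≤ W = subst (M ⊤ + V ⊤ ≤_) (cong₂ _+_ (∣⊤∣≡n n) (cong ψ (∩-identityˡ W))) (M⊤+V-≤ ⊤ W)

    -- M ⊤ + V A is ∣ A ∣ plus the minimum of ψ over subsets of A, so x is a loop of dual V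
    -- exactly when ψ attains its global minimum on a set avoiding x.
    dual-induced-loop⇔ : ∀ x → dual (induced (λ Z → dual M Z + g Z)) ⁅ x ⁆ ≡ 0 ⇔
                                ∃ λ Z → x ∉ Z × IsMinimiser (λ Z → M (∁ Z) + g Z) Z
    dual-induced-loop⇔ x = mk⇔ loop⇒ ⇒loop
      where
      open ≤-Reasoning
      loop⇒ : dual V ⁅ x ⁆ ≡ 0 → ∃ λ Z → x ∉ Z × IsMinimiser ψ Z
      loop⇒ loop with M⊤+V-attained (∁ ⁅ x ⁆)
      ... | X , eq = ∁ ⁅ x ⁆ ∩ X , x∉∁⁅x⁆∩X , λ W → +-cancelˡ-≤ n _ _ (begin
        n + ψ (∁ ⁅ x ⁆ ∩ X)                          ≡⟨ ∣⁅x⁆∣+[∣∁⁅x⁆∣+k]≡n+k x _ ⟨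
        ∣ ⁅ x ⁆ ∣ + (∣ ∁ ⁅ x ⁆ ∣ + ψ (∁ ⁅ x ⁆ ∩ X)) ≡⟨ cong (∣ ⁅ x ⁆ ∣ +_) eq ⟨
        ∣ ⁅ x ⁆ ∣ + (M ⊤ + V (∁ ⁅ x ⁆))             ≡⟨ x∙yz≈y∙xz (∣ ⁅ x ⁆ ∣) (M ⊤) _ ⟩
        M ⊤ + (∣ ⁅ x ⁆ ∣ + V (∁ ⁅ x ⁆))             ≤⟨ +-monoʳ-≤ (M ⊤) (m∸n≡0⇒m≤n loop) ⟩
        M ⊤ + V ⊤                                   ≤⟨ M⊤+V⊤≤ W ⟩
        n + ψ W                                     ∎)
        where
        x∉∁⁅x⁆∩X : x ∉ ∁ ⁅ x ⁆ ∩ X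
        x∉∁⁅x⁆∩X x∈ = x∈∁p⇒x∉p (proj₁ (x∈p∩q⁻ (∁ ⁅ x ⁆) X x∈)) (x∈⁅x⁆ x)

      ⇒loop : (∃ λ Z → x ∉ Z × IsMinimiser ψ Z) → dual V ⁅ x ⁆ ≡ 0
      ⇒loop (Z , x∉Z , Z-min) with M⊤+V-attained ⊤
      ... | X , eq = m≤n⇒m∸n≡0 (+-cancelˡ-≤ (M ⊤) _ _ (begin
        M ⊤ + (∣ ⁅ x ⁆ ∣ + V (∁ ⁅ x ⁆))               ≡⟨ x∙yz≈y∙xz (M ⊤) (∣ ⁅ x ⁆ ∣) _ ⟩
        ∣ ⁅ x ⁆ ∣ + (M ⊤ + V (∁ ⁅ x ⁆))               ≤⟨ +-monoʳ-≤ (∣ ⁅ x ⁆ ∣) (M⊤+V-≤ (∁ ⁅ x ⁆) Z) ⟩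
        ∣ ⁅ x ⁆ ∣ + (∣ ∁ ⁅ x ⁆ ∣ + ψ (∁ ⁅ x ⁆ ∩ Z))   ≡⟨ ∣⁅x⁆∣+[∣∁⁅x⁆∣+k]≡n+k x _ ⟩
        n + ψ (∁ ⁅ x ⁆ ∩ Z)                           ≡⟨ cong (λ Y → n + ψ Y) ∁⁅x⁆∩Z≡Z ⟩
        n + ψ Z                                       ≤⟨ +-monoʳ-≤ n (Z-min (⊤ ∩ X)) ⟩
        n + ψ (⊤ ∩ X)                                 ≡⟨ cong (_+ ψ (⊤ ∩ X)) (∣⊤∣≡n n) ⟨
        ∣ ⊤ {n} ∣ + ψ (⊤ ∩ X)                         ≡⟨ eq ⟨
        M ⊤ + V ⊤                                     ∎))
        where
        ∁⁅x⁆∩Z≡Z : ∁ ⁅ x ⁆ ∩ Z ≡ Z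
        ∁⁅x⁆∩Z≡Z = ⊆-antisym (p∩q⊆q (∁ ⁅ x ⁆) Z) λ y∈Z → x∈p∩q⁺ (x∉p⇒p⊆∁⁅x⁆ x∉Z y∈Z , y∈Z)

IsFlat? : ∀ {n} (r : RankFn n) F → Dec (IsFlat r F)
IsFlat? r F = all? λ x → ¬? (x ∈? F) →-dec ¬? (r (F ∪ ⁅ x ⁆) ≟ r F)

Comparable? : ∀ {n} (A B : Subset n) → Dec (Comparable A B)
Comparable? A B = (A ⊆? B) ⊎-dec (B ⊆? A)

-- Scan all subsets, keeping each flat that is comparable with everything kept so far.  A flat
-- comparable with the final chain was comparable with the chain at its turn, so it was kept.
module GreedyChain {n : ℕ} (r : RankFn n) where

  IsChainOfFlats : List (Subset n) → Set
  IsChainOfFlats ch =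
    (∀ {A} → A ∈ᴸ ch → IsFlat r A) × (∀ {A B} → A ∈ᴸ ch → B ∈ᴸ ch → Comparable A B)

  insert : List (Subset n) → Subset n → List (Subset n)
  insert ch S with IsFlat? r S ×-dec All.all? (Comparable? S) ch
  ... | yes _ = S ∷ ch
  ... | no  _ = ch

  insert-⊇ : ∀ ch S {A} → A ∈ᴸ ch → A ∈ᴸ insert ch S
  insert-⊇ ch S A∈ch with IsFlat? r S ×-dec All.all? (Comparable? S) ch
  ... | yes _ = there A∈ch
  ... | no  _ = A∈ch

  insert-∋ : ∀ ch S → IsFlat r S → All (Comparable S) ch → S ∈ᴸ insert ch S
  insert-∋ ch S S-flat S-comparable with IsFlat? r S ×-dec All.all? (Comparable? S) ch
  ... | yes _          = here refl
  ... | no  ¬admissible = ⊥-elim (¬admissible (S-flat , S-comparable))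

  insert-chain : ∀ ch S → IsChainOfFlats ch → IsChainOfFlats (insert ch S)
  insert-chain ch S (flats , comparable) with IsFlat? r S ×-dec All.all? (Comparable? S) ch
  ... | no  _                        = flats , comparable
  ... | yes (S-flat , S-comparable) = flats′ , comparable′
    where
    flats′ : ∀ {A} → A ∈ᴸ S ∷ ch → IsFlat r A
    flats′ (here refl) = S-flat
    flats′ (there A∈ch) = flats A∈ch
    comparable′ : ∀ {A B} → A ∈ᴸ S ∷ ch → B ∈ᴸ S ∷ ch → Comparable A B
    comparable′ (here refl)  (here refl)  = inj₁ ⊆-refl
    comparable′ (here refl)  (there B∈ch) = All.lookup S-comparable B∈ch
    comparable′ (there A∈ch) (here refl)  = swap (All.lookup S-comparable A∈ch)
    comparable′ (there A∈ch) (there B∈ch) = comparable A∈ch B∈ch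

  greedy : List (Subset n) → List (Subset n) → List (Subset n)
  greedy = foldl insert

  greedy-⊇ : ∀ ch Ss {A} → A ∈ᴸ ch → A ∈ᴸ greedy ch Ss
  greedy-⊇ ch []       A∈ch = A∈ch
  greedy-⊇ ch (S ∷ Ss) A∈ch = greedy-⊇ (insert ch S) Ss (insert-⊇ ch S A∈ch)

  greedy-chain : ∀ ch Ss → IsChainOfFlats ch → IsChainOfFlats (greedy ch Ss)
  greedy-chain ch []       chain = chain
  greedy-chain ch (S ∷ Ss) chain = greedy-chain (insert ch S) Ss (insert-chain ch S chain)

  greedy-maximal : ∀ ch Ss {F} → F ∈ᴸ Ss → IsFlat r F → All (Comparable F) (greedy ch Ss) →
                   F ∈ᴸ greedy ch Ss
  greedy-maximal ch (S ∷ Ss) (here refl) F-flat F-comparable =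
    greedy-⊇ (insert ch S) Ss (insert-∋ ch S F-flat (All.tabulate λ A∈ch →
      All.lookup F-comparable (greedy-⊇ (insert ch S) Ss (insert-⊇ ch S A∈ch))))
  greedy-maximal ch (S ∷ Ss) (there F∈Ss) F-flat F-comparable =
    greedy-maximal (insert ch S) Ss F∈Ss F-flat F-comparable

maxChainOfFlats : ∀ {n} (r : RankFn n) → ∃ (IsMaxChainOfFlats r)
maxChainOfFlats {n} r =
  let flats , comparable = greedy-chain [] (allSubsets n) ((λ ()) , (λ ()))
  in  greedy [] (allSubsets n) ,
      All.tabulate flats , All.tabulate (λ A∈ → All.tabulate (comparable A∈)) ,
      λ F F-flat F-comparable → greedy-maximal [] (allSubsets n) (∈-allSubsets F) F-flat F-comparable
  where open GreedyChain r

¬IndicatorZero : ∀ {n} (r : RankFn n) → ¬ IndicatorZero r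
¬IndicatorZero r indicatorZero with maxChainOfFlats r
... | ch , isMax = indicatorZero ch isMax

productIsZero⇔hasLoop : ∀ {n} (r s : RankFn n) → ProductIsZero r s ⇔ ∃ (IsLoop (r ∧ᴹ s))
productIsZero⇔hasLoop r s = mk⇔ to from
  where
  to : ProductIsZero r s → ∃ (IsLoop (r ∧ᴹ s))
  to isZero with any? (λ x → (r ∧ᴹ s) ⁅ x ⁆ ≟ 0)
  ... | yes loop = loop
  ... | no  none = ⊥-elim (¬IndicatorZero (r ∧ᴹ s) (isZero λ x isLoop → none (x , isLoop)))
  from : ∃ (IsLoop (r ∧ᴹ s)) → ProductIsZero r s
  from (x , isLoop) loopfree = ⊥-elim (loopfree x isLoop)

productIsZero⇔minimiser-avoiding :
  ∀ {n} {M N : RankFn n} → IsMatroid M → ∀ {g} → dual N ≗ induced g →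
  ProductIsZero M N ⇔ ∃₂ λ x Z → x ∉ Z × IsMinimiser (λ Z → M (∁ Z) + g Z) Z
productIsZero⇔minimiser-avoiding {M = M} {N} isMatroid {g} dual-N =
  ⇔-trans (productIsZero⇔hasLoop M N)
          (mk⇔ (map₂ (Equivalence.to (dual-induced-loop⇔ g _) ∘ trans (sym (M∧N≗ _))))
               (map₂ (trans (M∧N≗ _) ∘ Equivalence.from (dual-induced-loop⇔ g _))))
  where
  open Matroid isMatroid using (dual-mono; dual-induced-loop⇔)
  M∧N≗ : (M ∧ᴹ N) ≗ dual (induced (λ Z → dual M Z + g Z))
  M∧N≗ = dual-cong λ A → trans (induced-cong (λ Z → cong (dual M Z +_) (dual-N Z)) A)
                               (induced-absorb (dual M) g dual-mono A)

notWithin : ∀ {n} → Subset n → Subset n → ℕ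
notWithin G X = ∣ X ∩ ∁ G ∣ ⊓ 1

notWithin-mono : ∀ {n} (G : Subset n) → IsMonotone (notWithin G)
notWithin-mono G A⊆B = ⊓-monoˡ-≤ 1 (p⊆q⇒∣p∣≤∣q∣ (∩-monoˡ-⊆ (∁ G) A⊆B))

H-≡ : ∀ {n} (G A : Subset n) → H G A ≡ ∣ A ∩ G ∣ + ∣ A ∩ ∁ G ∣ ⊓ (∣ ∁ G ∣ ∸ 1)
H-≡ G A = cong₂ _+_
  (trans (cong (λ B → ∣ B ∣ ⊓ ∣ G ∣) (p∩q∩q≡p∩q A G)) (m≤n⇒m⊓n≡m (∣p∩q∣≤∣q∣ A G)))
  (cong (λ B → ∣ B ∣ ⊓ (∣ ∁ G ∣ ∸ 1)) (p∩q∩q≡p∩q A (∁ G)))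
  where
  p∩q∩q≡p∩q : ∀ {n} (p q : Subset n) → (p ∩ q) ∩ q ≡ p ∩ q
  p∩q∩q≡p∩q p q = trans (∩-assoc p q q) (cong (p ∩_) (∩-idem q))

private
  -- With s = ∣ X ∖ G ∣ and q = ∣ ∁ X ∖ G ∣: the truncation at ∣ ∁ G ∣ ∸ 1 only bites when s = 0.
  dual-H-arith : ∀ a p q s g h → a + (p + q) ≡ g + h → s + q ≡ h →
                 a + (p + q ⊓ (h ∸ 1)) ∸ (g + (h ∸ 1)) ≡ s ⊓ 1
  dual-H-arith a p q zero g .q sum refl = begin
    a + (p + q ⊓ (q ∸ 1)) ∸ (g + (q ∸ 1))
      ≡⟨ cong (λ m → a + (p + m) ∸ (g + (q ∸ 1))) (m≥n⇒m⊓n≡n (m∸n≤m q 1)) ⟩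
    a + (p + (q ∸ 1)) ∸ (g + (q ∸ 1))
      ≡⟨ cong (_∸ (g + (q ∸ 1))) (trans (sym (+-assoc a p _)) (cong (_+ (q ∸ 1)) a+p≡g)) ⟩
    g + (q ∸ 1) ∸ (g + (q ∸ 1))
      ≡⟨ n∸n≡0 (g + (q ∸ 1)) ⟩
    0                                     ∎
    where
    open ≡-Reasoning
    a+p≡g : a + p ≡ g
    a+p≡g = +-cancelʳ-≡ q (a + p) g (trans (+-assoc a p q) sum)
  dual-H-arith a p q (suc s) g .(suc s + q) sum refl = begin
    a + (p + q ⊓ (s + q)) ∸ (g + (s + q))
      ≡⟨ cong (λ m → a + (p + m) ∸ (g + (s + q))) (m≤n⇒m⊓n≡m (m≤n+m q s)) ⟩
    a + (p + q) ∸ (g + (s + q))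
      ≡⟨ cong (_∸ (g + (s + q))) (trans sum (+-suc g (s + q))) ⟩
    suc (g + (s + q)) ∸ (g + (s + q))
      ≡⟨ m+n∸n≡m 1 (g + (s + q)) ⟩
    1
      ≡⟨ cong suc (⊓-zeroʳ s) ⟨
    suc s ⊓ 1                             ∎
    where open ≡-Reasoning

dual-H : ∀ {n} (G : Subset n) → dual (H G) ≗ notWithin G
dual-H {n} G X = begin
  ∣ X ∣ + H G (∁ X) ∸ H G ⊤
    ≡⟨ cong₂ (λ a b → ∣ X ∣ + a ∸ b) (H-≡ G (∁ X)) H⊤≡ ⟩
  ∣ X ∣ + (∣ ∁ X ∩ G ∣ + ∣ ∁ X ∩ ∁ G ∣ ⊓ (∣ ∁ G ∣ ∸ 1)) ∸ (∣ G ∣ + (∣ ∁ G ∣ ∸ 1))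
    ≡⟨ dual-H-arith (∣ X ∣) (∣ ∁ X ∩ G ∣) (∣ ∁ X ∩ ∁ G ∣) (∣ X ∩ ∁ G ∣) (∣ G ∣) (∣ ∁ G ∣)
                    X-split X∖G-split ⟩
  notWithin G X ∎
  where
  open ≡-Reasoning
  H⊤≡ : H G ⊤ ≡ ∣ G ∣ + (∣ ∁ G ∣ ∸ 1)
  H⊤≡ = trans (H-≡ G ⊤) (cong₂ (λ B C → ∣ B ∣ + C)
                                 (∩-identityˡ G)
                                 (trans (cong (λ C → ∣ C ∣ ⊓ (∣ ∁ G ∣ ∸ 1)) (∩-identityˡ (∁ G)))
                                        (m≥n⇒m⊓n≡n (m∸n≤m ∣ ∁ G ∣ 1))))
  X-split : ∣ X ∣ + (∣ ∁ X ∩ G ∣ + ∣ ∁ X ∩ ∁ G ∣) ≡ ∣ G ∣ + ∣ ∁ G ∣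
  X-split = trans (cong (∣ X ∣ +_) (∣p∩q∣+∣p∩∁q∣≡∣p∣ (∁ X) G))
                  (trans (∣p∣+∣∁p∣≡n X) (sym (∣p∣+∣∁p∣≡n G)))
  X∖G-split : ∣ X ∩ ∁ G ∣ + ∣ ∁ X ∩ ∁ G ∣ ≡ ∣ ∁ G ∣
  X∖G-split = trans (cong₂ (λ B C → ∣ B ∣ + ∣ C ∣) (∩-comm X (∁ G)) (∩-comm (∁ X) (∁ G)))
                    (∣p∩q∣+∣p∩∁q∣≡∣p∣ (∁ G) X)

#notWithin : ∀ {n c} → (Fin c → Subset n) → Subset n → ℕ
#notWithin {c = zero}  G X = 0
#notWithin {c = suc c} G X = notWithin (G Fin.zero) X + #notWithin (G ∘ Fin.suc) X

⊆⇒notWithin≡0 : ∀ {n} {G X : Subset n} → X ⊆ G → notWithin G X ≡ 0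
⊆⇒notWithin≡0 {n} {G} {X} X⊆G = cong (_⊓ 1) (trans (cong ∣_∣ (Empty-unique X∖G-empty)) (∣⊥∣≡0 n))
  where
  X∖G-empty : Empty (X ∩ ∁ G)
  X∖G-empty (x , x∈X∖G) with x∈p∩q⁻ X (∁ G) x∈X∖G
  ... | x∈X , x∈∁G = x∈∁p⇒x∉p x∈∁G (X⊆G x∈X)

notWithin≡0⇒⊆ : ∀ {n} {G X : Subset n} → notWithin G X ≡ 0 → X ⊆ G
notWithin≡0⇒⊆ {G = G} {X} notWithin≡0 {x} x∈X with x ∈? G
... | yes x∈G = x∈G
... | no  x∉G =
  ⊥-elim (<⇒≢ (x∈p⇒0<∣p∣ (x∈p∩q⁺ (x∈X , x∉p⇒x∈∁p x∉G))) (sym (m⊓1≡0⇒m≡0 notWithin≡0)))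
  where
  m⊓1≡0⇒m≡0 : ∀ {m} → m ⊓ 1 ≡ 0 → m ≡ 0
  m⊓1≡0⇒m≡0 {zero} _ = refl

notWithin≡0⊎1 : ∀ {n} (G X : Subset n) → notWithin G X ≡ 0 ⊎ notWithin G X ≡ 1
notWithin≡0⊎1 G X with ∣ X ∩ ∁ G ∣
... | zero  = inj₁ refl
... | suc k = inj₂ (cong suc (⊓-zeroʳ k))

notWithin-⊤ : ∀ {n} {G : Subset n} → ∣ G ∣ < n → notWithin G ⊤ ≡ 1
notWithin-⊤ {G = G} ∣G∣<n = trans (cong (λ B → ∣ B ∣ ⊓ 1) (∩-identityˡ (∁ G)))
  (m≥n⇒m⊓n≡n (subst (1 ≤_) (sym (∣∁p∣≡n∸∣p∣ G)) (m<n⇒0<n∸m ∣G∣<n)))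

IsChain : ∀ {n c} → (Fin c → Subset n) → Set
IsChain G = ∀ i j → toℕ i < toℕ j → G i ⊆ G j

module _ {n : ℕ} where

  IsChain-tail : ∀ {c} {G : Fin (suc c) → Subset n} → IsChain G → IsChain (G ∘ Fin.suc)
  IsChain-tail G-chain i j i<j = G-chain (Fin.suc i) (Fin.suc j) (s≤s i<j)

  ⊆-head⇒⊆-all : ∀ {c} {G : Fin (suc c) → Subset n} {X} →
                 IsChain G → X ⊆ G Fin.zero → ∀ i → X ⊆ G i
  ⊆-head⇒⊆-all G-chain X⊆G₀ Fin.zero    = X⊆G₀
  ⊆-head⇒⊆-all G-chain X⊆G₀ (Fin.suc i) = ⊆-trans X⊆G₀ (G-chain Fin.zero (Fin.suc i) (s≤s z≤n))

  #notWithin≡0 : ∀ {c} (G : Fin c → Subset n) {X} → (∀ i → X ⊆ G i) → #notWithin G X ≡ 0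
  #notWithin≡0 {zero}  G X⊆G = refl
  #notWithin≡0 {suc c} G X⊆G =
    cong₂ _+_ (⊆⇒notWithin≡0 (X⊆G Fin.zero)) (#notWithin≡0 (G ∘ Fin.suc) (X⊆G ∘ Fin.suc))

  #notWithin-⊤ : ∀ {c} (G : Fin c → Subset n) → (∀ i → ∣ G i ∣ < n) → #notWithin G ⊤ ≡ c
  #notWithin-⊤ {zero}  G G-proper = refl
  #notWithin-⊤ {suc c} G G-proper =
    cong₂ _+_ (notWithin-⊤ (G-proper Fin.zero)) (#notWithin-⊤ (G ∘ Fin.suc) (G-proper ∘ Fin.suc))

  #notWithin-≤ : ∀ {c} {G : Fin c → Subset n} {X} →
                 IsChain G → ∀ i → X ⊆ G i → #notWithin G X ≤ toℕ i
  #notWithin-≤ {G = G} G-chain Fin.zero X⊆G₀ = ≤-reflexive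
    (#notWithin≡0 G (⊆-head⇒⊆-all G-chain X⊆G₀))
  #notWithin-≤ {G = G} G-chain (Fin.suc i) X⊆Gᵢ =
    +-mono-≤ (m⊓n≤n _ 1) (#notWithin-≤ (IsChain-tail G-chain) i X⊆Gᵢ)

  -- Along a chain, X ⊈ Gᵢ exactly for the first #notWithin G X indices.
  #notWithin-< : ∀ {c} {G : Fin c → Subset n} {X} → IsChain G → #notWithin G X < c →
                 ∃ λ i → toℕ i ≡ #notWithin G X × X ⊆ G i
  #notWithin-< {suc c} {G} {X} G-chain #<c with notWithin≡0⊎1 (G Fin.zero) X
  ... | inj₁ ≡0 = Fin.zero , sym (#notWithin≡0 G (⊆-head⇒⊆-all G-chain X⊆G₀)) , X⊆G₀
    where
    X⊆G₀ : X ⊆ G Fin.zero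
    X⊆G₀ = notWithin≡0⇒⊆ ≡0
  ... | inj₂ ≡1
    with #notWithin-< (IsChain-tail G-chain)
           (≤-pred (subst (λ k → k + #notWithin (G ∘ Fin.suc) X < suc c) ≡1 #<c))
  ...   | i , i≡# , X⊆Gᵢ =
    Fin.suc i , trans (cong suc i≡#) (cong (_+ #notWithin (G ∘ Fin.suc) X) (sym ≡1)) , X⊆Gᵢ

#notWithin-⊥ : ∀ {n c} (G : Fin c → Subset n) → #notWithin G ⊥ ≡ 0
#notWithin-⊥ G = #notWithin≡0 G (λ _ → ⊥⊆)

dual-MG : ∀ {n c} (G : Fin c → Subset n) → dual (MG G) ≗ induced (#notWithin G)
dual-MG {n} {zero} G A = begin
  ∣ A ∣ + ∣ ∁ A ∣ ∸ ∣ ⊤ {n} ∣ ≡⟨ cong₂ _∸_ (∣p∣+∣∁p∣≡n A) (∣⊤∣≡n n) ⟩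
  n ∸ n                     ≡⟨ n∸n≡0 n ⟩
  0                         ≡⟨ n≤0⇒n≡0 (induced-≤-self (λ _ → 0) A) ⟨
  induced (λ _ → 0) A       ∎
  where open ≡-Reasoning
dual-MG {c = suc c} G A =
  trans (dual-cong (dual-cong union≗) A) (dual-induced-involutive (#notWithin G) (#notWithin-⊥ G) A)
  where
  union≗ : (dual (H (G Fin.zero)) ∨ᴹ dual (MG (G ∘ Fin.suc))) ≗ induced (#notWithin G)
  union≗ B = trans
    (induced-cong (λ Z → cong₂ _+_ (dual-H (G Fin.zero) Z) (dual-MG (G ∘ Fin.suc) Z)) B)
    (induced-absorb (notWithin (G Fin.zero)) (#notWithin (G ∘ Fin.suc))
                    (notWithin-mono (G Fin.zero)) B)

HasCoveringFlat : ∀ {n c} → RankFn n → (Fin c → Subset n) → Set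
HasCoveringFlat {n} {c} M G =
  Σ (Fin c) λ i → Σ (Subset n) λ F → IsFlat M F × M F ≡ c ∸ toℕ i × F ∪ G i ≡ ⊤

module _ {n : ℕ} {M : RankFn n} (isMatroid : IsMatroid M) (loopfree : Loopfree M)
         {c : ℕ} {G : Fin c → Subset n} (G-chain : IsChain G) (G-proper : ∀ i → ∣ G i ∣ < n)
         (c<rank : c < rank M) where
  open IsMatroid isMatroid
  open Matroid isMatroid

  private
    ψ : Subset n → ℕ
    ψ Z = M (∁ Z) + #notWithin G Z

    ψ⊤≡c : ψ ⊤ ≡ c
    ψ⊤≡c = cong₂ _+_ (trans (cong M ∁⊤≡⊥) M⊥≡0) (#notWithin-⊤ G G-proper)

  covering-flat : ∀ {x Z} → x ∉ Z → IsMinimiser ψ Z → HasCoveringFlat M G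
  covering-flat {x} {Z} x∉Z Z-min = covering (#notWithin-< G-chain #<c)
    where
    ψZ≤c : ψ Z ≤ c
    ψZ≤c = subst (ψ Z ≤_) ψ⊤≡c (Z-min ⊤)
    0<M[∁Z] : 0 < M (∁ Z)
    0<M[∁Z] = ≤-trans (n≢0⇒n>0 (loopfree x)) (monotone (x∉p⇒⁅x⁆⊆∁p x∉Z))
    #<c : #notWithin G Z < c
    #<c = <-≤-trans (m<n+m _ 0<M[∁Z]) ψZ≤c
    covering : (∃ λ i → toℕ i ≡ #notWithin G Z × Z ⊆ G i) → HasCoveringFlat M G
    covering (i , i≡# , Z⊆Gᵢ) =
      let F , F-flat , ∁Z⊆F , MF≡c∸i = flat-extension (∁ Z) (c ∸ toℕ i) M[∁Z]≤c∸i c∸i≤rank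
      in  i , F , F-flat , MF≡c∸i , ∁p⊆q⇒p∪q≡⊤ (⊆-trans (∁p⊆q⇒∁q⊆p ∁Z⊆F) Z⊆Gᵢ)
      where
      M[∁Z]≤c∸i : M (∁ Z) ≤ c ∸ toℕ i
      M[∁Z]≤c∸i = m+n≤o⇒m≤o∸n (M (∁ Z)) (subst (λ k → M (∁ Z) + k ≤ c) (sym i≡#) ψZ≤c)
      c∸i≤rank : c ∸ toℕ i ≤ M ⊤
      c∸i≤rank = ≤-trans (m∸n≤m c (toℕ i)) (<⇒≤ c<rank)

  minimiser-from-covering-flat : HasCoveringFlat M G → ∃₂ λ x Z → x ∉ Z × IsMinimiser ψ Z
  minimiser-from-covering-flat (i , F , _ , MF≡c∸i , F∪Gᵢ≡⊤) =
    let x , x∈F = positive-rank⇒nonempty (subst (0 <_) (sym MF≡c∸i) (m<n⇒0<n∸m (toℕ<n i)))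
    in  minimiser-avoiding ψ (x∈p⇒x∉∁p x∈F) ψ[∁F]≤ψ⊤
    where
    open ≤-Reasoning
    ψ[∁F]≤ψ⊤ : ψ (∁ F) ≤ ψ ⊤
    ψ[∁F]≤ψ⊤ = begin
      M (∁ (∁ F)) + #notWithin G (∁ F)
        ≤⟨ +-mono-≤ (≤-reflexive (trans (cong M (∁-involutive F)) MF≡c∸i))
                    (#notWithin-≤ G-chain i (p∪q≡⊤⇒∁p⊆q F∪Gᵢ≡⊤)) ⟩
      c ∸ toℕ i + toℕ i ≡⟨ m∸n+n≡m (<⇒≤ (toℕ<n i)) ⟩
      c                 ≡⟨ ψ⊤≡c ⟨
      ψ ⊤               ∎

  productIsZero⇔hasCoveringFlat : ProductIsZero M (MG G) ⇔ HasCoveringFlat M G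
  productIsZero⇔hasCoveringFlat = ⇔-trans
    (productIsZero⇔minimiser-avoiding {N = MG G} isMatroid (dual-MG G))
    (mk⇔ (λ (_ , _ , x∉Z , Z-min) → covering-flat x∉Z Z-min) minimiser-from-covering-flat)

proposition5p12 : (n : ℕ) (M : RankFn n) → IsMatroid M → Loopfree M → 2 ≤ rank M →
    (c : ℕ) (G : Fin c → Subset n) →
    (∀ (i j : Fin c) → toℕ i < toℕ j → G i ⊂ G j) →
    (∀ (i : Fin c) → ∣ G i ∣ ≤ n ∸ 2) →
    c < n ∸ corank M →
    ProductIsZero M (MG G) ⇔
      Σ (Fin c) (λ i → Σ (Subset n) (λ F →
        IsFlat M F × M F ≡ c ∸ toℕ i × F ∪ G i ≡ ⊤))
proposition5p12 n M isMatroid loopfree 2≤rank c G G-⊂-chain ∣G∣≤n∸2 c<n∸corank =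
  productIsZero⇔hasCoveringFlat isMatroid loopfree G-chain G-proper c<rank
  where
  open Matroid isMatroid using (M⊤≤n)
  G-chain : IsChain G
  G-chain i j i<j = p⊂q⇒p⊆q (G-⊂-chain i j i<j)
  G-proper : ∀ i → ∣ G i ∣ < n
  G-proper i = ≤-<-trans (∣G∣≤n∸2 i) (∸-monoʳ-< {n} {2} {0} (s≤s z≤n) (≤-trans 2≤rank M⊤≤n))
  c<rank : c < rank M
  c<rank = subst (c <_) (m∸[m∸n]≡n M⊤≤n) c<n∸corank
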